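{- For every $n \in \mathbb{N}$ there exists a mapping $\phi \colon \{0,1\}^n \to \{0,1\}^n$ from ${\sf Dictator}$ to ${\sf XOR}$ (i.e. a bijection with ${\sf Dictator}(z) = {\sf XOR}(\phi(z))$ for all $z$) such that each output bit of $\phi$ depends on at most 3 input bits, $\phi$ is 2-Lipschitz, and $\phi^{ -1}$ is $O(\log n)$-Lipschitz (i.e. $C\log n$-Lipschitz for an absolute constant $C$). Furthermore, $\phi$ is a linear operator over $GF(2)$.
   Context: ${\sf Dictator}(x) = x_1$ and ${\sf XOR}(x) = \sum_{i=1}^n x_i \bmod 2$ for $x \in \{0,1\}^n$. A map $\phi$ is $L$-Lipschitz if ${\sf dist}(\phi(x),\phi(y)) \le L\,{\sf dist}(x,y)$ for all $x,y$, where ${\sf dist}$ is Hamming distance. -}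

module Defs where

open import Data.Bool using (Bool; true; false; _xor_; _≟_)
open import Relation.Nullary using (yes; no)
open import Data.Nat using (ℕ; zero; suc; _+_; _*_; _≤_)
open import Data.Fin using (Fin)
open import Data.Vec using (Vec; []; _∷_; head; lookup; zipWith; foldr)
open import Data.List using (List; length)
open import Data.List.Membership.Propositional using (_∈_)
open import Data.Product using (Σ; _×_)
open import Relation.Binary.PropositionalEquality using (_≡_)

Dictator : ∀ {m} → Vec Bool (suc m) → Bool
Dictator x = head x

XOR : ∀ {n} → Vec Bool n → Bool
XOR = foldr _ _xor_ false

dist : ∀ {n} → Vec Bool n → Vec Bool n → ℕ
dist [] [] = 0
dist (a ∷ x) (b ∷ y) with a ≟ b
... | yes _ = dist x y
... | no _ = suc (dist x y)

Lipschitz : ∀ {n k} → ℕ → (Vec Bool n → Vec Bool k) → Set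
Lipschitz L f = ∀ x y → dist (f x) (f y) ≤ L * dist x y

DependsOnlyOn : ∀ {n k} → (Vec Bool n → Vec Bool k) → Fin k → List (Fin n) → Set
DependsOnlyOn f i S =
  ∀ x y → (∀ j → j ∈ S → lookup x j ≡ lookup y j) → lookup (f x) i ≡ lookup (f y) i

Locality : ∀ {n k} → ℕ → (Vec Bool n → Vec Bool k) → Set
Locality d f = ∀ i → Σ (List _) λ S → (length S ≤ d) × DependsOnlyOn f i S

-- linear over GF(2): additive w.r.t. coordinatewise xor
-- (over GF(2) additivity is equivalent to linearity)
GF2Linear : ∀ {n k} → (Vec Bool n → Vec Bool k) → Set
GF2Linear f = ∀ x y → f (zipWith _xor_ x y) ≡ zipWith _xor_ (f x) (f y)

module Submission where

-- The map φ is read off a binary tree t with n nodes and depth at most d,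
-- whose nodes index the n coordinates (in preorder).  The forward map
-- childSum t replaces the bit at each node by the xor of the bits at the
-- node and at its (at most two) children; its inverse subtreeSum t puts at
-- each node the xor of all bits in the subtree below it.
--   * Telescoping: XOR (childSum t z) is the bit at the root, i.e. z₁.
--   * Each output bit of childSum t reads a node and its children: 3 bits.
--   * Both maps are GF(2)-linear, so their Lipschitz constants are bounds
--     on how much they can increase Hamming weight.  An input bit of
--     childSum t reaches only its own node and its parent (constant 2); an
--     input bit of subtreeSum t reaches its ancestors (constant d).
-- Finally a balanced tree on n = m + 1 nodes has depth 1 + ⌊log₂ n⌋.

open import Defs
open import Data.Bool using (Bool; true; false; _xor_)
open import Data.Bool.Properties using (xor-assoc; xor-same; xor-identityʳ; xor-∧-commutativeRing)
open import Data.Nat using (ℕ; zero; suc; _*_; _+_; _≤_; _<_; _^_; z≤n; s≤s; ⌈_/2⌉; ⌊_/2⌋; _<?_)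
open import Data.Nat.Properties
open import Data.Nat.Logarithm using (⌊log₂_⌋; ⌊log₂⌋-mono-≤; ⌊log₂[2^n]⌋≡n)
open import Data.Nat.Solver using (module +-*-Solver)
open import Data.Fin using (Fin; _↑ˡ_; _↑ʳ_) renaming (zero to fz; suc to fs)
open import Data.Vec using (Vec; []; _∷_; _++_; lookup; zipWith)
open import Data.Vec.Properties using (lookup-++ˡ; lookup-++ʳ; zipWith-++)
open import Data.List using (List; length; map) renaming ([] to []ˡ; _∷_ to _∷ˡ_; _++_ to _++ˡ_)
open import Data.List.Properties using (length-map; length-++)
open import Data.List.Membership.Propositional using (_∈_)
open import Data.List.Membership.Propositional.Properties using (∈-map⁺; ∈-++⁺ˡ; ∈-++⁺ʳ)
open import Data.List.Relation.Unary.Any using (here; there)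
open import Data.Product using (Σ; _×_; _,_)
open import Algebra.Bundles using (CommutativeRing)
open import Algebra.Properties.CommutativeSemigroup
  (CommutativeRing.+-commutativeSemigroup xor-∧-commutativeRing) using (interchange)
open import Function.Bundles using (_↔_; Inverse; mk↔ₛ′)
open import Relation.Nullary using (yes; no; contradiction)
open import Relation.Binary.PropositionalEquality

bit : Bool → ℕ
bit false = 0
bit true  = 1

weight : ∀ {n} → Vec Bool n → ℕ
weight []      = 0
weight (b ∷ x) = bit b + weight x

infixr 5 _⊕_
_⊕_ : ∀ {n} → Vec Bool n → Vec Bool n → Vec Bool n
_⊕_ = zipWith _xor_

-- The first coordinate, with a default for the empty vector
-- (the value at the root of a possibly empty subtree).
root : ∀ {n} → Vec Bool n → Bool
root []      = false
root (x ∷ _) = x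

xor-cancelʳ : ∀ x y → (x xor y) xor y ≡ x
xor-cancelʳ x y = begin
  (x xor y) xor y ≡⟨ xor-assoc x y y ⟩
  x xor (y xor y) ≡⟨ cong (x xor_) (xor-same y) ⟩
  x xor false     ≡⟨ xor-identityʳ x ⟩
  x               ∎
  where open ≡-Reasoning

bit-xor : ∀ a b → bit (a xor b) ≤ bit a + bit b
bit-xor false b     = ≤-refl
bit-xor true  false = ≤-refl
bit-xor true  true  = z≤n

bit-xor₃ : ∀ a b c → bit (a xor b xor c) ≤ bit a + (bit b + bit c)
bit-xor₃ a b c = ≤-trans (bit-xor a (b xor c)) (+-monoʳ-≤ (bit a) (bit-xor b c))

weight-++ : ∀ {a b} (u : Vec Bool a) (v : Vec Bool b) → weight (u ++ v) ≡ weight u + weight v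
weight-++ []      v = refl
weight-++ (x ∷ u) v = trans (cong (bit x +_) (weight-++ u v)) (sym (+-assoc (bit x) _ _))

XOR-++ : ∀ {a b} (u : Vec Bool a) (v : Vec Bool b) → XOR (u ++ v) ≡ XOR u xor XOR v
XOR-++ []      v = refl
XOR-++ (x ∷ u) v = trans (cong (x xor_) (XOR-++ u v)) (sym (xor-assoc x (XOR u) (XOR v)))

parity≤weight : ∀ {n} (u : Vec Bool n) → bit (XOR u) ≤ weight u
parity≤weight []      = z≤n
parity≤weight (x ∷ u) = ≤-trans (bit-xor x (XOR u)) (+-monoʳ-≤ (bit x) (parity≤weight u))

root-⊕ : ∀ {n} (u v : Vec Bool n) → root (u ⊕ v) ≡ root u xor root v
root-⊕ []      []      = refl
root-⊕ (x ∷ u) (y ∷ v) = refl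

dist≡weight-⊕ : ∀ {n} (x y : Vec Bool n) → dist x y ≡ weight (x ⊕ y)
dist≡weight-⊕ []          []          = refl
dist≡weight-⊕ (false ∷ x) (false ∷ y) = dist≡weight-⊕ x y
dist≡weight-⊕ (false ∷ x) (true  ∷ y) = cong suc (dist≡weight-⊕ x y)
dist≡weight-⊕ (true  ∷ x) (false ∷ y) = cong suc (dist≡weight-⊕ x y)
dist≡weight-⊕ (true  ∷ x) (true  ∷ y) = dist≡weight-⊕ x y

-- A linear map is L-Lipschitz as soon as it increases weight by at most
-- the factor L, since dist (f x) (f y) = weight (f (x ⊕ y)).
linear-lipschitz : ∀ {n k} {f : Vec Bool n → Vec Bool k} L → GF2Linear f →
  (∀ z → weight (f z) ≤ L * weight z) → Lipschitz L f
linear-lipschitz {f = f} L linear bound x y = begin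
  dist (f x) (f y)     ≡⟨ dist≡weight-⊕ (f x) (f y) ⟩
  weight (f x ⊕ f y)   ≡⟨ cong weight (linear x y) ⟨
  weight (f (x ⊕ y))   ≤⟨ bound (x ⊕ y) ⟩
  L * weight (x ⊕ y)   ≡⟨ cong (L *_) (dist≡weight-⊕ x y) ⟨
  L * dist x y         ∎
  where open ≤-Reasoning

inverse-linear : ∀ {n k} {f : Vec Bool n → Vec Bool k} {g : Vec Bool k → Vec Bool n} →
  GF2Linear f → (∀ w → f (g w) ≡ w) → (∀ z → g (f z) ≡ z) → GF2Linear g
inverse-linear {f = f} {g} linear fg gf x y = begin
  g (x ⊕ y)                 ≡⟨ cong₂ (λ a b → g (a ⊕ b)) (fg x) (fg y) ⟨
  g (f (g x) ⊕ f (g y))     ≡⟨ cong g (linear (g x) (g y)) ⟨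
  g (f (g x ⊕ g y))         ≡⟨ gf (g x ⊕ g y) ⟩
  g x ⊕ g y                 ∎
  where open ≡-Reasoning

LocalBit : ∀ {n k} → ℕ → (Vec Bool n → Vec Bool k) → Fin k → Set
LocalBit d f i = Σ (List _) λ S → (length S ≤ d) × DependsOnlyOn f i S

localBit-restrict : ∀ {n m k l d} (g : Vec Bool m → Vec Bool k) (h : Vec Bool n → Vec Bool l)
  {i : Fin k} {i′ : Fin l} (e : Fin m → Fin n) (π : Vec Bool n → Vec Bool m) →
  (∀ z j → lookup (π z) j ≡ lookup z (e j)) →
  (∀ z → lookup (h z) i′ ≡ lookup (g (π z)) i) →
  LocalBit d g i → LocalBit d h i′
localBit-restrict g h {i} {i′} e π π-coord h-via-g (S , |S|≤d , dep) =
  map e S , ≤-trans (≤-reflexive (length-map e S)) |S|≤d , dep′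
  where
  dep′ : DependsOnlyOn h i′ (map e S)
  dep′ x y agree = begin
    lookup (h x) i′     ≡⟨ h-via-g x ⟩
    lookup (g (π x)) i  ≡⟨ dep (π x) (π y) agreeπ ⟩
    lookup (g (π y)) i  ≡⟨ h-via-g y ⟨
    lookup (h y) i′     ∎
    where
    open ≡-Reasoning
    agreeπ : ∀ j → j ∈ S → lookup (π x) j ≡ lookup (π y) j
    agreeπ j j∈S = trans (π-coord x j) (trans (agree (e j) (∈-map⁺ e j∈S)) (sym (π-coord y j)))

-- Binary trees of depth at most d with n nodes.
data Tree : ℕ → ℕ → Set where
  leaf : ∀ {d} → Tree d 0
  node : ∀ {d a b} → Tree d a → Tree d b → Tree (suc d) (suc (a + b))

-- A vector indexed by the nodes of node l r is laid out in preorder as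
-- x ∷ (u ++ v): root, left subtree, right subtree.  Split is the view
-- exposing this decomposition.
data Split {A : Set} (a : ℕ) {b : ℕ} : Vec A (a + b) → Set where
  mk : (u : Vec A a) (v : Vec A b) → Split a (u ++ v)

split : ∀ {A : Set} a {b} (xs : Vec A (a + b)) → Split a xs
split zero    xs       = mk [] xs
split (suc a) (x ∷ xs) with split a xs
... | mk u v = mk (x ∷ u) v

split-++ : ∀ {A : Set} {a b} (u : Vec A a) (v : Vec A b) → split a (u ++ v) ≡ mk u v
split-++ []      v = refl
split-++ (x ∷ u) v rewrite split-++ u v = refl

childSum : ∀ {d n} → Tree d n → Vec Bool n → Vec Bool n
childSum leaf []                       = []
childSum (node {a = a} l r) (x ∷ xs) with split a xs
... | mk u v = (x xor root u xor root v) ∷ (childSum l u ++ childSum r v)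

subtreeSum : ∀ {d n} → Tree d n → Vec Bool n → Vec Bool n
subtreeSum leaf []                       = []
subtreeSum (node {a = a} l r) (x ∷ xs) with split a xs
... | mk u v = (x xor XOR u xor XOR v) ∷ (subtreeSum l u ++ subtreeSum r v)

childSum-node : ∀ {d a b} (l : Tree d a) (r : Tree d b) x u v →
  childSum (node l r) (x ∷ (u ++ v)) ≡ (x xor root u xor root v) ∷ (childSum l u ++ childSum r v)
childSum-node l r x u v rewrite split-++ u v = refl

subtreeSum-node : ∀ {d a b} (l : Tree d a) (r : Tree d b) x u v →
  subtreeSum (node l r) (x ∷ (u ++ v)) ≡ (x xor XOR u xor XOR v) ∷ (subtreeSum l u ++ subtreeSum r v)
subtreeSum-node l r x u v rewrite split-++ u v = refl

-- Telescoping: every input bit except the root one occurs twice in the sum.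
XOR-childSum : ∀ {d n} (t : Tree d n) z → XOR (childSum t z) ≡ root z
XOR-childSum leaf [] = refl
XOR-childSum (node {a = a} l r) (x ∷ xs) with split a xs
... | mk u v = begin
  (x xor root u xor root v) xor XOR (childSum l u ++ childSum r v)
    ≡⟨ cong ((x xor root u xor root v) xor_) (XOR-++ (childSum l u) (childSum r v)) ⟩
  (x xor root u xor root v) xor XOR (childSum l u) xor XOR (childSum r v)
    ≡⟨ cong₂ (λ p q → (x xor root u xor root v) xor p xor q) (XOR-childSum l u) (XOR-childSum r v) ⟩
  (x xor (root u xor root v)) xor (root u xor root v)
    ≡⟨ xor-cancelʳ x (root u xor root v) ⟩
  x ∎
  where open ≡-Reasoning

root-subtreeSum : ∀ {d n} (t : Tree d n) w → root (subtreeSum t w) ≡ XOR w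
root-subtreeSum leaf [] = refl
root-subtreeSum (node {a = a} l r) (x ∷ xs) with split a xs
... | mk u v = cong (x xor_) (sym (XOR-++ u v))

-- The two maps are mutually inverse: by the two facts above, at each node the
-- root correction introduced by one map is removed by the other.
subtreeSum-childSum : ∀ {d n} (t : Tree d n) z → subtreeSum t (childSum t z) ≡ z
subtreeSum-childSum leaf [] = refl
subtreeSum-childSum (node {a = a} l r) (x ∷ xs) with split a xs
... | mk u v rewrite subtreeSum-node l r (x xor root u xor root v) (childSum l u) (childSum r v)
                   | XOR-childSum l u | XOR-childSum r v
                   | subtreeSum-childSum l u | subtreeSum-childSum r v
                   | xor-cancelʳ x (root u xor root v) = refl

childSum-subtreeSum : ∀ {d n} (t : Tree d n) w → childSum t (subtreeSum t w) ≡ w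
childSum-subtreeSum leaf [] = refl
childSum-subtreeSum (node {a = a} l r) (x ∷ xs) with split a xs
... | mk u v rewrite childSum-node l r (x xor XOR u xor XOR v) (subtreeSum l u) (subtreeSum r v)
                   | root-subtreeSum l u | root-subtreeSum r v
                   | childSum-subtreeSum l u | childSum-subtreeSum r v
                   | xor-cancelʳ x (XOR u xor XOR v) = refl

childSum-linear : ∀ {d n} (t : Tree d n) → GF2Linear (childSum t)
childSum-linear leaf [] [] = refl
childSum-linear (node {a = a} l r) (x ∷ xs) (y ∷ ys) with split a xs | split a ys
... | mk u v | mk u′ v′ = begin
  childSum (node l r) ((x xor y) ∷ ((u ++ v) ⊕ (u′ ++ v′)))
    ≡⟨ cong (λ w → childSum (node l r) ((x xor y) ∷ w)) (zipWith-++ _xor_ u v u′ v′) ⟩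
  childSum (node l r) ((x xor y) ∷ ((u ⊕ u′) ++ (v ⊕ v′)))
    ≡⟨ childSum-node l r (x xor y) (u ⊕ u′) (v ⊕ v′) ⟩
  ((x xor y) xor root (u ⊕ u′) xor root (v ⊕ v′)) ∷ (childSum l (u ⊕ u′) ++ childSum r (v ⊕ v′))
    ≡⟨ cong₂ _∷_ rootBit (cong₂ _++_ (childSum-linear l u u′) (childSum-linear r v v′)) ⟩
  ((x xor root u xor root v) xor (y xor root u′ xor root v′))
    ∷ ((childSum l u ⊕ childSum l u′) ++ (childSum r v ⊕ childSum r v′))
    ≡⟨ cong (_ ∷_) (zipWith-++ _xor_ (childSum l u) (childSum r v) (childSum l u′) (childSum r v′)) ⟨
  ((x xor root u xor root v) ∷ (childSum l u ++ childSum r v))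
    ⊕ ((y xor root u′ xor root v′) ∷ (childSum l u′ ++ childSum r v′)) ∎
  where
  open ≡-Reasoning
  rootBit : (x xor y) xor root (u ⊕ u′) xor root (v ⊕ v′)
          ≡ (x xor root u xor root v) xor (y xor root u′ xor root v′)
  rootBit rewrite root-⊕ u u′ | root-⊕ v v′
                | interchange (root u) (root u′) (root v) (root v′)
                | interchange x y (root u xor root v) (root u′ xor root v′) = refl

-- An input bit at a node contributes to the output at the node and at its
-- parent; the parent contribution of the root is accounted for by the
-- extra summand bit (root z).
childSum-weight : ∀ {d n} (t : Tree d n) z → weight (childSum t z) + bit (root z) ≤ 2 * weight z
childSum-weight leaf [] = z≤n
childSum-weight (node {a = a} l r) (x ∷ xs) with split a xs
... | mk u v rewrite weight-++ (childSum l u) (childSum r v) | weight-++ u v =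
  arithmetic (bit (x xor root u xor root v)) (bit x) (bit (root u)) (bit (root v))
    (weight (childSum l u)) (weight (childSum r v)) (weight u) (weight v)
    (bit-xor₃ x (root u) (root v)) (childSum-weight l u) (childSum-weight r v)
  where
  arithmetic : ∀ c e hu hv Wl Wr wu wv → c ≤ e + (hu + hv) → Wl + hu ≤ 2 * wu → Wr + hv ≤ 2 * wv →
    c + (Wl + Wr) + e ≤ 2 * (e + (wu + wv))
  arithmetic c e hu hv Wl Wr wu wv hc hl hr = begin
    c + (Wl + Wr) + e                  ≤⟨ +-monoˡ-≤ e (+-monoˡ-≤ (Wl + Wr) hc) ⟩
    e + (hu + hv) + (Wl + Wr) + e      ≡⟨ solve 5 (λ e hu hv Wl Wr →
                                            e :+ (hu :+ hv) :+ (Wl :+ Wr) :+ e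
                                            := (e :+ e) :+ ((Wl :+ hu) :+ (Wr :+ hv))) refl e hu hv Wl Wr ⟩
    (e + e) + ((Wl + hu) + (Wr + hv))  ≤⟨ +-monoʳ-≤ (e + e) (+-mono-≤ hl hr) ⟩
    (e + e) + (2 * wu + 2 * wv)        ≡⟨ solve 3 (λ e wu wv →
                                            (e :+ e) :+ (con 2 :* wu :+ con 2 :* wv)
                                            := con 2 :* (e :+ (wu :+ wv))) refl e wu wv ⟩
    2 * (e + (wu + wv))                ∎
    where
    open ≤-Reasoning
    open +-*-Solver

-- An input bit at a node contributes to the outputs at its ancestors,
-- of which there are at most d.
subtreeSum-weight : ∀ {d n} (t : Tree d n) w → weight (subtreeSum t w) ≤ d * weight w
subtreeSum-weight leaf [] = z≤n
subtreeSum-weight (node {d = d} {a = a} l r) (x ∷ xs) with split a xs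
... | mk u v rewrite weight-++ (subtreeSum l u) (subtreeSum r v) | weight-++ u v = begin
  bit (x xor XOR u xor XOR v) + (weight (subtreeSum l u) + weight (subtreeSum r v))
    ≤⟨ +-mono-≤ rootBound (+-mono-≤ (subtreeSum-weight l u) (subtreeSum-weight r v)) ⟩
  (bit x + (weight u + weight v)) + (d * weight u + d * weight v)
    ≡⟨ cong ((bit x + (weight u + weight v)) +_) (*-distribˡ-+ d (weight u) (weight v)) ⟨
  (bit x + (weight u + weight v)) + d * (weight u + weight v)
    ≤⟨ +-monoʳ-≤ (bit x + (weight u + weight v)) (*-monoʳ-≤ d (m≤n+m (weight u + weight v) (bit x))) ⟩
  suc d * (bit x + (weight u + weight v)) ∎
  where
  open ≤-Reasoning
  rootBound : bit (x xor XOR u xor XOR v) ≤ bit x + (weight u + weight v)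
  rootBound = ≤-trans (bit-xor₃ x (XOR u) (XOR v))
                      (+-monoʳ-≤ (bit x) (+-mono-≤ (parity≤weight u) (parity≤weight v)))

childSum-lipschitz : ∀ {d n} (t : Tree d n) → Lipschitz 2 (childSum t)
childSum-lipschitz t = linear-lipschitz 2 (childSum-linear t)
  (λ z → ≤-trans (m≤m+n _ (bit (root z))) (childSum-weight t z))

subtreeSum-lipschitz : ∀ {d n} (t : Tree d n) → Lipschitz d (subtreeSum t)
subtreeSum-lipschitz {d} t = linear-lipschitz d
  (inverse-linear (childSum-linear t) (childSum-subtreeSum t) (subtreeSum-childSum t))
  (subtreeSum-weight t)

leftIndex : ∀ {a} b → Fin a → Fin (suc (a + b))
leftIndex b k = fs (k ↑ˡ b)

rightIndex : ∀ a {b} → Fin b → Fin (suc (a + b))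
rightIndex a k = fs (a ↑ʳ k)

data Block (a b : ℕ) : Fin (a + b) → Set where
  inLeft  : (k : Fin a) → Block a b (k ↑ˡ b)
  inRight : (k : Fin b) → Block a b (a ↑ʳ k)

block : ∀ a b i → Block a b i
block zero    b i      = inRight i
block (suc a) b fz     = inLeft fz
block (suc a) b (fs i) with block a b i
... | inLeft k  = inLeft (fs k)
... | inRight k = inRight k

leftPart : ∀ a {b} → Vec Bool (suc (a + b)) → Vec Bool a
leftPart a (x ∷ xs) with split a xs
... | mk u v = u

rightPart : ∀ a {b} → Vec Bool (suc (a + b)) → Vec Bool b
rightPart a (x ∷ xs) with split a xs
... | mk u v = v

lookup-leftPart : ∀ a {b} z (k : Fin a) → lookup (leftPart a {b} z) k ≡ lookup z (leftIndex b k)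
lookup-leftPart a (x ∷ xs) k with split a xs
... | mk u v = sym (lookup-++ˡ u v k)

lookup-rightPart : ∀ a {b} z (k : Fin b) → lookup (rightPart a z) k ≡ lookup z (rightIndex a k)
lookup-rightPart a (x ∷ xs) k with split a xs
... | mk u v = sym (lookup-++ʳ u v k)

childSum-left : ∀ {d a b} (l : Tree d a) (r : Tree d b) z k →
  lookup (childSum (node l r) z) (leftIndex b k) ≡ lookup (childSum l (leftPart a z)) k
childSum-left {a = a} l r (x ∷ xs) k with split a xs
... | mk u v = lookup-++ˡ (childSum l u) (childSum r v) k

childSum-right : ∀ {d a b} (l : Tree d a) (r : Tree d b) z k →
  lookup (childSum (node l r) z) (rightIndex a k) ≡ lookup (childSum r (rightPart a z)) k
childSum-right {a = a} l r (x ∷ xs) k with split a xs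
... | mk u v = lookup-++ʳ (childSum l u) (childSum r v) k

childSum-rootBit : ∀ {d a b} (l : Tree d a) (r : Tree d b) x xs →
  lookup (childSum (node l r) (x ∷ xs)) fz ≡ x xor root (leftPart a (x ∷ xs)) xor root (rightPart a (x ∷ xs))
childSum-rootBit {a = a} l r x xs with split a xs
... | mk u v = refl

rootIndex : ∀ a → List (Fin a)
rootIndex zero    = []ˡ
rootIndex (suc a) = fz ∷ˡ []ˡ

root-agree : ∀ {a} (u u′ : Vec Bool a) → (∀ k → k ∈ rootIndex a → lookup u k ≡ lookup u′ k) → root u ≡ root u′
root-agree []      []       agree = refl
root-agree (x ∷ u) (x′ ∷ u′) agree = agree fz (here refl)

rootDeps : ∀ a b → List (Fin (suc (a + b)))
rootDeps a b = fz ∷ˡ (map (leftIndex b) (rootIndex a) ++ˡ map (rightIndex a) (rootIndex b))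

rootDeps-length : ∀ a b → length (rootDeps a b) ≤ 3
rootDeps-length a b
  rewrite length-++ (map (leftIndex b) (rootIndex a)) {map (rightIndex a) (rootIndex b)}
        | length-map (leftIndex b) (rootIndex a) | length-map (rightIndex a) (rootIndex b) =
  s≤s (+-mono-≤ (atMostOne a) (≤-trans (atMostOne b) (s≤s z≤n)))
  where
  atMostOne : ∀ a → length (rootIndex a) ≤ 1
  atMostOne zero    = z≤n
  atMostOne (suc a) = s≤s z≤n

childSum-rootDeps : ∀ {d a b} (l : Tree d a) (r : Tree d b) → DependsOnlyOn (childSum (node l r)) fz (rootDeps a b)
childSum-rootDeps {a = a} {b} l r (x ∷ xs) (y ∷ ys) agree
  rewrite childSum-rootBit l r x xs | childSum-rootBit l r y ys =
  cong₂ _xor_ (agree fz (here refl)) (cong₂ _xor_ leftRoot rightRoot)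
  where
  leftRoot : root (leftPart a (x ∷ xs)) ≡ root (leftPart a (y ∷ ys))
  leftRoot = root-agree (leftPart a (x ∷ xs)) (leftPart a (y ∷ ys)) λ k k∈ →
    trans (lookup-leftPart a (x ∷ xs) k)
      (trans (agree (leftIndex b k) (there (∈-++⁺ˡ (∈-map⁺ (leftIndex b) k∈))))
        (sym (lookup-leftPart a (y ∷ ys) k)))
  rightRoot : root (rightPart a (x ∷ xs)) ≡ root (rightPart a (y ∷ ys))
  rightRoot = root-agree (rightPart a (x ∷ xs)) (rightPart a (y ∷ ys)) λ k k∈ →
    trans (lookup-rightPart a (x ∷ xs) k)
      (trans (agree (rightIndex a k)
                    (there (∈-++⁺ʳ (map (leftIndex b) (rootIndex a)) (∈-map⁺ (rightIndex a) k∈))))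
        (sym (lookup-rightPart a (y ∷ ys) k)))

childSum-local : ∀ {d n} (t : Tree d n) → Locality 3 (childSum t)
childSum-local (node {a = a} {b} l r) fz = rootDeps a b , rootDeps-length a b , childSum-rootDeps l r
childSum-local (node {a = a} {b} l r) (fs i) with block a b i
... | inLeft k  = localBit-restrict (childSum l) (childSum (node l r))
                    (leftIndex b) (leftPart a) (lookup-leftPart a) (λ z → childSum-left l r z k) (childSum-local l k)
... | inRight k = localBit-restrict (childSum r) (childSum (node l r))
                    (rightIndex a) (rightPart a) (lookup-rightPart a) (λ z → childSum-right l r z k) (childSum-local r k)

⌈k/2⌉<m : ∀ k m → suc k < 2 * m → ⌈ k /2⌉ < m
⌈k/2⌉<m k m k<2m = ≤-trans (⌈n/2⌉-mono k<2m) (≤-reflexive ⌈2m/2⌉≡m)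
  where
  ⌈2m/2⌉≡m : ⌈ 2 * m /2⌉ ≡ m
  ⌈2m/2⌉≡m = trans (cong ⌈_/2⌉ (cong (m +_) (+-identityʳ m))) (sym (n≡⌈n+n/2⌉ m))

balanced : ∀ d n → n < 2 ^ d → Tree d n
balanced zero    zero    _ = leaf
balanced zero    (suc n) (s≤s ())
balanced (suc d) zero    _ = leaf
balanced (suc d) (suc k) n<2^d =
  subst (Tree (suc d)) (cong suc (⌊n/2⌋+⌈n/2⌉≡n k))
    (node (balanced d ⌊ k /2⌋ (≤-<-trans (⌊n/2⌋≤⌈n/2⌉ k) ⌈k/2⌉<2^d)) (balanced d ⌈ k /2⌉ ⌈k/2⌉<2^d))
  where
  ⌈k/2⌉<2^d : ⌈ k /2⌉ < 2 ^ d
  ⌈k/2⌉<2^d = ⌈k/2⌉<m k (2 ^ d) n<2^d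

-- If 2^(1 + ⌊log₂ n⌋) ≤ n then 1 + ⌊log₂ n⌋ ≤ ⌊log₂ n⌋ by monotonicity.
n<2^[1+⌊log₂n⌋] : ∀ n → n < 2 ^ suc ⌊log₂ n ⌋
n<2^[1+⌊log₂n⌋] n with n <? 2 ^ suc ⌊log₂ n ⌋
... | yes n<2^L = n<2^L
... | no  n≮2^L = contradiction
  (subst (_≤ ⌊log₂ n ⌋) (⌊log₂[2^n]⌋≡n (suc ⌊log₂ n ⌋)) (⌊log₂⌋-mono-≤ (≮⇒≥ n≮2^L)))
  1+n≰n

theorem2 : Σ ℕ λ C → (m : ℕ) →
    Σ (Vec Bool (suc m) ↔ Vec Bool (suc m)) λ φ →
      ((z : Vec Bool (suc m)) → Dictator z ≡ XOR (Inverse.to φ z))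
      × Locality 3 (Inverse.to φ)
      × Lipschitz 2 (Inverse.to φ)
      × Lipschitz (C * (1 + ⌊log₂ (suc m) ⌋)) (Inverse.from φ)
      × GF2Linear (Inverse.to φ)
theorem2 = 1 , λ m →
  let depth = 1 + ⌊log₂ (suc m) ⌋
      t     = balanced depth (suc m) (n<2^[1+⌊log₂n⌋] (suc m))
  in  mk↔ₛ′ (childSum t) (subtreeSum t) (childSum-subtreeSum t) (subtreeSum-childSum t)
    , (λ { (x ∷ xs) → sym (XOR-childSum t (x ∷ xs)) })
    , childSum-local t
    , childSum-lipschitz t
    , subst (λ L → Lipschitz L (subtreeSum t)) (sym (*-identityˡ depth)) (subtreeSum-lipschitz t)
    , childSum-linear t
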